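{- For any two finite, simple, connected graphs $G$ and $H$, $\zeta(G \square H) \geq \max\{\zeta(G), \zeta(H)\}$.
   Context: All graphs are finite, simple, undirected and connected. The localization game on a graph $G$ is played by a Cop controlling $k$ cops and a Robber. The Robber first chooses a vertex $r$, unknown to the Cop. In each turn the Cop probes a set $B=\{b_1,\dots,b_k\}$ of $k$ vertices (repetitions across turns allowed) and receives the distance vector $[d_G(r,b_1),\dots,d_G(r,b_k)]$. If the Cop can determine $r$ exactly from the information received, the Cop wins; otherwise the Robber may stay at $r$ or move to a neighbour of $r$, and the next turn begins. The Cop wins if the Robber is located after finitely many turns. The localization number $\zeta(G)$ is the least positive integer $k$ such that the Cop has a winning strategy with $k$ cops against every strategy of the Robber. $G \square H$ denotes the Cartesian product: vertex set $V(G)\times V(H)$, with $(u,u')$ adjacent to $(v,v')$ iff either $u=v$ and $u'v'\in E(H)$, or $u'=v'$ and $uv\in E(G)$. -}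

module Defs where

open import Data.Nat using (ℕ; zero; suc; _≤_)
open import Data.Bool using (Bool; true; false; if_then_else_; _∨_; _∧_)
open import Data.List using (List; []; _∷_; length; cartesianProduct)
open import Data.Bool.ListAction using (any)
open import Data.List.Membership.Propositional using (_∈_)
open import Data.List.Membership.Propositional.Properties using (∈-cartesianProduct⁺)
open import Data.Vec using (Vec)
import Data.Vec as Vec
open import Data.Product using (Σ; ∃; _×_; _,_)
open import Data.Product.Properties using (≡-dec)
open import Data.Sum using (_⊎_; inj₁; inj₂)
open import Data.Empty using (⊥)
open import Relation.Nullary using (¬_; does; yes; no)
open import Relation.Nullary.Decidable using (_×-dec_; _⊎-dec_)
open import Relation.Binary.Definitions using (Decidable; DecidableEquality)
open import Relation.Binary.PropositionalEquality using (_≡_; refl)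

-- The vertex type is finite: 'vertices' enumerates every vertex.
-- Edges form a decidable, symmetric, irreflexive relation (simple graph:
-- no loops; multi-edges cannot be expressed by a relation).

record Graph : Set₁ where
  field
    V        : Set
    _≟_      : DecidableEquality V
    vertices : List V
    complete : ∀ v → v ∈ vertices
    E        : V → V → Set
    E?       : Decidable E
    E-sym    : ∀ {u v} → E u v → E v u
    E-irrefl : ∀ {u} → ¬ E u u

open Graph public

data Walk (G : Graph) : V G → V G → ℕ → Set where
  here : ∀ {u} → Walk G u u zero
  step : ∀ {u w v n} → E G u w → Walk G w v n → Walk G u v (suc n)

-- connected (and nonempty)
Connected : Graph → Set
Connected G = V G × (∀ u v → ∃ λ n → Walk G u v n)

-- Graph distance d_G(u,v), computed by breadth-first search:
-- reach G k u v = true iff there is a walk from u to v of length ≤ k.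

reach : (G : Graph) → ℕ → V G → V G → Bool
reach G zero    u v = does (_≟_ G u v)
reach G (suc k) u v = does (_≟_ G u v) ∨ any (λ w → does (E? G u w) ∧ reach G k w v) (vertices G)

-- least d < b with f d = true, and b if there is none
least : (ℕ → Bool) → ℕ → ℕ
least f zero    = zero
least f (suc b) = if f zero then zero else suc (least (λ d → f (suc d)) b)

-- In a connected graph the distance is < |V|, so the search bound
-- |V| = length (vertices G) suffices.
dist : (G : Graph) → V G → V G → ℕ
dist G u v = least (λ d → reach G d u v) (length (vertices G))

_□_ : Graph → Graph → Graph
G □ H = record
  { V        = V G × V H
  ; _≟_      = ≡-dec (_≟_ G) (_≟_ H)
  ; vertices = cartesianProduct (vertices G) (vertices H)
  ; complete = λ { (u , u') → ∈-cartesianProduct⁺ (complete G u) (complete H u') }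
  ; E        = PE
  ; E?       = PE?
  ; E-sym    = PE-sym
  ; E-irrefl = PE-irrefl
  }
  where
  PE : V G × V H → V G × V H → Set
  PE (u , u') (v , v') = (u ≡ v × E H u' v') ⊎ (u' ≡ v' × E G u v)
  PE? : Decidable PE
  PE? (u , u') (v , v') = (_≟_ G u v ×-dec E? H u' v') ⊎-dec (_≟_ H u' v' ×-dec E? G u v)
  PE-sym : ∀ {x y} → PE x y → PE y x
  PE-sym (inj₁ (refl , e)) = inj₁ (refl , E-sym H e)
  PE-sym (inj₂ (refl , e)) = inj₂ (refl , E-sym G e)
  PE-irrefl : ∀ {x} → ¬ PE x x
  PE-irrefl (inj₁ (_ , e)) = E-irrefl H e
  PE-irrefl (inj₂ (_ , e)) = E-irrefl G e

-- A probe: k vertices (repetitions allowed).  A response: distance vector.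
Probe : Graph → ℕ → Set
Probe G k = Vec (V G) k

Response : ℕ → Set
Response k = Vec ℕ k

-- A (deterministic) Cop strategy chooses the next probe from the list of
-- responses received so far (most recent first).  The Cop's own earlier
-- probes are determined by these, so this is no loss of generality.
Strategy : Graph → ℕ → Set
Strategy G k = List (Response k) → Probe G k

-- A Robber play: the robber's position at every turn; each move is to stay
-- or move to a neighbour.  Since the Cop's strategy is deterministic and
-- known, every Robber strategy amounts to such a sequence.
RobberPlay : Graph → Set
RobberPlay G = ℕ → V G

ValidPlay : (G : Graph) → RobberPlay G → Set
ValidPlay G r = ∀ t → r (suc t) ≡ r t ⊎ E G (r t) (r (suc t))

-- the responses received in turns 0 .. t-1 (most recent first)
history : (G : Graph) {k : ℕ} → Strategy G k → RobberPlay G → ℕ → List (Response k)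
history G σ r zero    = []
history G σ r (suc t) =
  Vec.map (dist G (r t)) (σ (history G σ r t)) ∷ history G σ r t

-- After the probe of turn t the Cop knows r t exactly: every valid play
-- producing the same responses in turns 0..t has the same position at t.
Located : (G : Graph) {k : ℕ} → Strategy G k → RobberPlay G → ℕ → Set
Located G σ r t =
  ∀ r' → ValidPlay G r' → history G σ r' (suc t) ≡ history G σ r (suc t) → r' t ≡ r t

CopWins : Graph → ℕ → Set
CopWins G k = Σ (Strategy G k) λ σ → ∀ r → ValidPlay G r → ∃ λ t → Located G σ r t

IsLocalizationNumber : Graph → ℕ → Set
IsLocalizationNumber G k = 1 ≤ k × CopWins G k × (∀ j → 1 ≤ j → CopWins G j → k ≤ j)

-- A play on G (or H) can be simulated on G □ H by a Robber confined to the
-- layer G × {h₀}.  For such a Robber the distance to a probe (g , h) is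
-- d_G(r , g) + d_H(h₀ , h), and the second summand depends only on the probe.
-- So a Cop on G who probes the first coordinates of the probes of a winning
-- strategy on G □ H, and adds the known offsets to the answers, receives exactly
-- the answers of the product game and wins with the same number of cops.
module Submission where

open import Defs
open import Data.Nat using (ℕ; zero; suc; _+_; _≤_; _<_; _⊔_; z≤n; s≤s; _<?_)
open import Data.Nat.Induction using (<-wellFounded)
open import Data.Nat.Properties
  using (≤-refl; ≤-antisym; ≮⇒≥; m<n+m; +-mono-≤; +-suc; +-comm; ⊔-lub)
open import Data.Bool using (Bool; true; false; T)
open import Data.Bool.Properties using (T-∧; T-∨)
open import Data.Unit using (tt)
open import Data.List using (List; []; _∷_; length)
open import Data.List.Relation.Unary.Any using (satisfied; index)
open import Data.List.Relation.Unary.Any.Properties using (any⁺; any⁻)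
open import Data.List.Membership.Propositional using (lose)
open import Data.List.Membership.Setoid.Properties using (index-injective)
open import Data.Fin using (toℕ)
open import Data.Fin.Properties using (pigeonhole; toℕ≤pred[n])
import Data.Vec as Vec
open import Data.Product using (∃; ∃₂; _×_; _,_; proj₁; proj₂)
import Data.Sum as Sum
open import Data.Sum using (inj₁; inj₂)
open import Data.Empty using (⊥-elim)
open import Function using (_∘_; Equivalence)
open import Induction.WellFounded using (Acc; acc)
open import Relation.Nullary using (Dec; does; yes; no)
open import Relation.Binary.PropositionalEquality

open Equivalence using (to; from)

private
  variable
    m n : ℕ

does-sound : {A : Set} (a? : Dec A) → T (does a?) → A
does-sound (yes a) _ = a

does-complete : {A : Set} (a? : Dec A) → A → T (does a?)
does-complete (yes _) _ = tt
does-complete (no ¬a) a = ¬a a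

least-minimal : (f : ℕ → Bool) (b : ℕ) {d : ℕ} → T (f d) → least f b ≤ d
least-minimal f zero _ = z≤n
least-minimal f (suc b) fd with f zero in f0
... | true = z≤n
least-minimal f (suc b) {zero}  fd | false = ⊥-elim (subst T f0 fd)
least-minimal f (suc b) {suc d} fd | false = s≤s (least-minimal (f ∘ suc) b fd)

least-satisfies : (f : ℕ → Bool) (b : ℕ) {d : ℕ} → d < b → T (f d) → T (f (least f b))
least-satisfies f (suc b) _ fd with f zero in f0
... | true = subst T (sym f0) tt
least-satisfies f (suc b) {zero}  _         fd | false = ⊥-elim (subst T f0 fd)
least-satisfies f (suc b) {suc d} (s≤s d<b) fd | false = least-satisfies (f ∘ suc) b d<b fd

module _ {G : Graph} where

  _++ʷ_ : ∀ {u w v} → Walk G u w m → Walk G w v n → Walk G u v (m + n)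
  here     ++ʷ b = b
  step e a ++ʷ b = step e (a ++ʷ b)

  ≡⇒walk : ∀ {u v} → u ≡ v → Walk G u v 0
  ≡⇒walk refl = here

  -- The vertex reached after i steps; past the end it stays at the endpoint.
  _at_ : ∀ {u v} → Walk G u v n → ℕ → V G
  _at_ {u = u} w          zero    = u
  _at_ {u = u} here       (suc i) = u
  _at_         (step _ w) (suc i) = w at i

  suffix : ∀ {u v} (w : Walk G u v n) (j : ℕ) → j ≤ n →
           ∃ λ m → j + m ≡ n × Walk G (w at j) v m
  suffix {n = n} w zero _ = n , refl , w
  suffix (step _ w) (suc j) (s≤s j≤n) with suffix w j j≤n
  ... | m , j+m≡n , rest = m , cong suc j+m≡n , rest

  shortcut : ∀ {u v} (w : Walk G u v n) {i j : ℕ} → i < j → j ≤ n → w at i ≡ w at j →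
             ∃ λ m → m < n × Walk G u v m
  shortcut w {zero} {j} 0<j j≤n loop with suffix w j j≤n
  ... | m , j+m≡n , rest =
    m , subst (m <_) j+m≡n (m<n+m m 0<j) , subst (λ x → Walk G x _ m) (sym loop) rest
  shortcut (step e w) {suc i} (s≤s i<j) (s≤s j≤n) loop with shortcut w i<j j≤n loop
  ... | m , m<n , w′ = suc m , s≤s m<n , step e w′

  long-walk-shortcut : ∀ {u v} → length (vertices G) ≤ n → Walk G u v n →
                       ∃ λ m → m < n × Walk G u v m
  long-walk-shortcut |V|≤n w with pigeonhole (s≤s |V|≤n) (λ i → index (complete G (w at toℕ i)))
  ... | i , j , i<j , same-index =
    shortcut w i<j (toℕ≤pred[n] j)
      (index-injective (setoid (V G)) (complete G _) (complete G _) same-index)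

  shorten-acc : ∀ {u v} → Acc _<_ n → Walk G u v n →
                ∃ λ m → m < length (vertices G) × Walk G u v m
  shorten-acc {n = n} (acc shorter) w with n <? length (vertices G)
  ... | yes n<|V| = n , n<|V| , w
  ... | no n≮|V| with long-walk-shortcut (≮⇒≥ n≮|V|) w
  ...   | m , m<n , w′ = shorten-acc (shorter m<n) w′

  shorten : ∀ {u v} → Walk G u v n → ∃ λ m → m < length (vertices G) × Walk G u v m
  shorten = shorten-acc (<-wellFounded _)

reach-sound : (G : Graph) (k : ℕ) {u v : V G} → T (reach G k u v) →
              ∃ λ n → n ≤ k × Walk G u v n
reach-sound G zero {u} {v} r = 0 , z≤n , ≡⇒walk (does-sound (_≟_ G u v) r)
reach-sound G (suc k) {u} {v} r with to T-∨ r
... | inj₁ u≡v = 0 , z≤n , ≡⇒walk (does-sound (_≟_ G u v) u≡v)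
... | inj₂ via-neighbour with satisfied (any⁻ _ (vertices G) via-neighbour)
...   | w , edge-and-reach with to T-∧ edge-and-reach
...     | e , r′ with reach-sound G k r′
...       | n , n≤k , walk = suc n , s≤s n≤k , step (does-sound (E? G u w) e) walk

reach-complete : {G : Graph} {u v : V G} {n k : ℕ} → Walk G u v n → n ≤ k → T (reach G k u v)
reach-complete {G = G} {u = u} {k = zero} here _ = does-complete (_≟_ G u u) refl
reach-complete {G = G} {u = u} {k = suc k} here _ = from T-∨ (inj₁ (does-complete (_≟_ G u u) refl))
reach-complete {G = G} {u = u} {k = suc k} (step {w = w} e walk) (s≤s n≤k) =
  from T-∨ (inj₂ (any⁺ _ (lose (complete G w)
    (from T-∧ (does-complete (E? G u w) e , reach-complete walk n≤k)))))

module _ {G : Graph} {u v : V G} where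

  dist-≤ : Walk G u v m → dist G u v ≤ m
  dist-≤ w = least-minimal (λ d → reach G d u v) (length (vertices G)) (reach-complete w ≤-refl)

  dist-walk : Walk G u v n → Walk G u v (dist G u v)
  dist-walk w with shorten w
  ... | m , m<|V| , short
    with reach-sound G (dist G u v) (least-satisfies (λ d → reach G d u v) (length (vertices G)) m<|V|
                                       (reach-complete short ≤-refl))
  ...   | d , d≤dist , geodesic = subst (Walk G u v) (≤-antisym d≤dist (dist-≤ geodesic)) geodesic

module _ {G H : Graph} where

  walk-□ˡ : ∀ {g g′} (h : V H) → Walk G g g′ m → Walk (G □ H) (g , h) (g′ , h) m
  walk-□ˡ h here       = here
  walk-□ˡ h (step e w) = step (inj₂ (refl , e)) (walk-□ˡ h w)

  walk-□ʳ : ∀ {h h′} (g : V G) → Walk H h h′ m → Walk (G □ H) (g , h) (g , h′) m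
  walk-□ʳ g here       = here
  walk-□ʳ g (step e w) = step (inj₁ (refl , e)) (walk-□ʳ g w)

  walk-□-split : ∀ {g h g′ h′} → Walk (G □ H) (g , h) (g′ , h′) n →
                 ∃₂ λ m₁ m₂ → m₁ + m₂ ≡ n × Walk G g g′ m₁ × Walk H h h′ m₂
  walk-□-split here = 0 , 0 , refl , here , here
  walk-□-split (step (inj₁ (refl , e)) w) with walk-□-split w
  ... | m₁ , m₂ , eq , a , b = m₁ , suc m₂ , trans (+-suc m₁ m₂) (cong suc eq) , a , step e b
  walk-□-split (step (inj₂ (refl , e)) w) with walk-□-split w
  ... | m₁ , m₂ , eq , a , b = suc m₁ , m₂ , cong suc eq , step e a , b

  dist-□ : Connected G → Connected H → ∀ g h g′ h′ →
           dist (G □ H) (g , h) (g′ , h′) ≡ dist G g g′ + dist H h h′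
  dist-□ (_ , connG) (_ , connH) g h g′ h′ = ≤-antisym (dist-≤ product-walk) lower
    where
    product-walk : Walk (G □ H) (g , h) (g′ , h′) (dist G g g′ + dist H h h′)
    product-walk = walk-□ˡ h (dist-walk (proj₂ (connG g g′))) ++ʷ walk-□ʳ g′ (dist-walk (proj₂ (connH h h′)))

    lower : dist G g g′ + dist H h h′ ≤ dist (G □ H) (g , h) (g′ , h′)
    lower with walk-□-split (dist-walk product-walk)
    ... | m₁ , m₂ , eq , a , b = subst (dist G g g′ + dist H h h′ ≤_) eq (+-mono-≤ (dist-≤ a) (dist-≤ b))

record OffsetRetract (K P : Graph) : Set where
  field
    embed         : V K → V P
    project       : V P → V K
    offset        : V P → ℕ
    embed-edge    : ∀ {x y} → E K x y → E P (embed x) (embed y)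
    project-embed : ∀ x → project (embed x) ≡ x
    dist-embed    : ∀ x p → dist P (embed x) p ≡ dist K x (project p) + offset p

module Simulation {K P : Graph} (ρ : OffsetRetract K P) {c : ℕ} (σ : Strategy P c) where
  open OffsetRetract ρ

  add-offsets : Vec.Vec (V P) n → Vec.Vec ℕ n → Vec.Vec ℕ n
  add-offsets ps ds = Vec.zipWith (λ d p → d + offset p) ds ps

  simulate : List (Response c) → List (Response c)
  simulate []        = []
  simulate (ds ∷ hs) = add-offsets (σ (simulate hs)) ds ∷ simulate hs

  projected : Strategy K c
  projected hs = Vec.map project (σ (simulate hs))

  embed-valid : ∀ {r} → ValidPlay K r → ValidPlay P (embed ∘ r)
  embed-valid valid t = Sum.map (cong embed) embed-edge (valid t)

  embedded-response : ∀ x (ps : Vec.Vec (V P) n) →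
    Vec.map (dist P (embed x)) ps ≡ add-offsets ps (Vec.map (dist K x) (Vec.map project ps))
  embedded-response x Vec.[]       = refl
  embedded-response x (p Vec.∷ ps) = cong₂ Vec._∷_ (dist-embed x p) (embedded-response x ps)

  embedded-history : ∀ r t → history P σ (embed ∘ r) t ≡ simulate (history K projected r t)
  embedded-history r zero    = refl
  embedded-history r (suc t) rewrite embedded-history r t =
    cong (_∷ simulate (history K projected r t)) (embedded-response (r t) (σ (simulate (history K projected r t))))

copWins-retract : ∀ {K P c} → OffsetRetract K P → CopWins P c → CopWins K c
copWins-retract {K} {P} ρ (σ , wins) = projected , located
  where
  open OffsetRetract ρ
  open Simulation ρ σ

  located : ∀ r → ValidPlay K r → ∃ λ t → Located K projected r t
  located r valid with wins (embed ∘ r) (embed-valid valid)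
  ... | t , found = t , λ r′ valid′ same → begin
    r′ t                   ≡⟨ sym (project-embed (r′ t)) ⟩
    project (embed (r′ t)) ≡⟨ cong project (found (embed ∘ r′) (embed-valid valid′) (same-in-P r′ same)) ⟩
    project (embed (r t))  ≡⟨ project-embed (r t) ⟩
    r t                    ∎
    where
    open ≡-Reasoning
    same-in-P : ∀ r′ → history K projected r′ (suc t) ≡ history K projected r (suc t) →
                history P σ (embed ∘ r′) (suc t) ≡ history P σ (embed ∘ r) (suc t)
    same-in-P r′ same = begin
      history P σ (embed ∘ r′) (suc t)          ≡⟨ embedded-history r′ (suc t) ⟩
      simulate (history K projected r′ (suc t)) ≡⟨ cong simulate same ⟩
      simulate (history K projected r (suc t))  ≡⟨ embedded-history r (suc t) ⟨
      history P σ (embed ∘ r) (suc t)           ∎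

module _ {G H : Graph} (connG : Connected G) (connH : Connected H) where

  □-retractˡ : OffsetRetract G (G □ H)
  □-retractˡ = record
    { embed         = λ g → g , proj₁ connH
    ; project       = proj₁
    ; offset        = λ p → dist H (proj₁ connH) (proj₂ p)
    ; embed-edge    = λ e → inj₂ (refl , e)
    ; project-embed = λ _ → refl
    ; dist-embed    = λ g p → dist-□ connG connH g (proj₁ connH) (proj₁ p) (proj₂ p)
    }

  □-retractʳ : OffsetRetract H (G □ H)
  □-retractʳ = record
    { embed         = λ h → proj₁ connG , h
    ; project       = proj₂
    ; offset        = λ p → dist G (proj₁ connG) (proj₁ p)
    ; embed-edge    = λ e → inj₁ (refl , e)
    ; project-embed = λ _ → refl
    ; dist-embed    = λ h p → trans (dist-□ connG connH (proj₁ connG) h (proj₁ p) (proj₂ p))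
                                    (+-comm (dist G (proj₁ connG) (proj₁ p)) _)
    }

theorem3p4 : (G H : Graph) → Connected G → Connected H →
    (a b c : ℕ) → IsLocalizationNumber G a → IsLocalizationNumber H b →
    IsLocalizationNumber (G □ H) c → a ⊔ b ≤ c
theorem3p4 G H connG connH a b c (_ , _ , a-least) (_ , _ , b-least) (1≤c , c-wins , _) =
  ⊔-lub (a-least c 1≤c (copWins-retract (□-retractˡ connG connH) c-wins))
        (b-least c 1≤c (copWins-retract (□-retractʳ connG connH) c-wins))
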